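{- Let $m,n>2$ and let $C$ be an $m\times n$ evolutionary stable configuration. Then $C_{m-1,2}=C_{m-1,n-1}=0$.
   Context: An $m\times n$ configuration is a $0$-$1$ matrix $C=(C_{i,j})$, $1\le i\le m$, $1\le j\le n$; row $1$ is the northernmost and row $m$ the southernmost, column $1$ the westernmost and column $n$ the easternmost; $C_{i,j}=1$ means lot $(i,j)$ is occupied by a house. A house at $(i,j)$ is blocked if $j>1$ and $C_{i,j-1}=1$, and $j<n$ and $C_{i,j+1}=1$, and $i<m$ and $C_{i+1,j}=1$. $C$ is permissible if no house is blocked; it is maximal if it is permissible and occupying any single empty lot yields a non-permissible configuration. A maximal configuration is resistant to predators if for every empty lot $(i,j)$, after setting $C_{i,j}=1$ the new house at $(i,j)$ is blocked; it is resistant to altruists if for every empty lot $(i,j)$, after setting $C_{i,j}=1$ some house at a position other than $(i,j)$ is blocked. An evolutionary stable configuration is a maximal configuration resistant to both predators and altruists. -}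

module Defs where

open import Data.Nat using (ℕ; suc)
open import Data.Fin using (Fin; toℕ; _≟_)
open import Data.Bool using (Bool; true; false; if_then_else_)
open import Data.Product using (Σ; _×_; ∃)
open import Relation.Binary.PropositionalEquality using (_≡_)
open import Relation.Nullary using (¬_; does)

-- An m×n configuration, 0-based indices: row index 0 is northernmost
-- (paper's row 1), column index 0 is westernmost (paper's column 1).
-- true = occupied by a house.
Config : ℕ → ℕ → Set
Config m n = Fin m → Fin n → Bool

occupy : ∀ {m n} → Config m n → Fin m → Fin n → Config m n
occupy C i j i' j' =
  if does (i' ≟ i) then (if does (j' ≟ j) then true else C i' j') else C i' j'

Blocked : ∀ {m n} → Config m n → Fin m → Fin n → Set
Blocked {m} {n} C i j =
  (C i j ≡ true)
  × (Σ (Fin n) λ jw → (suc (toℕ jw) ≡ toℕ j) × (C i jw ≡ true))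
  × (Σ (Fin n) λ je → (toℕ je ≡ suc (toℕ j)) × (C i je ≡ true))
  × (Σ (Fin m) λ is → (toℕ is ≡ suc (toℕ i)) × (C is j ≡ true))

Permissible : ∀ {m n} → Config m n → Set
Permissible C = ∀ i j → ¬ Blocked C i j

Maximal : ∀ {m n} → Config m n → Set
Maximal C = Permissible C × (∀ i j → C i j ≡ false → ¬ Permissible (occupy C i j))

ResistantToPredators : ∀ {m n} → Config m n → Set
ResistantToPredators C =
  Maximal C × (∀ i j → C i j ≡ false → Blocked (occupy C i j) i j)

ResistantToAltruists : ∀ {m n} → Config m n → Set
ResistantToAltruists {m} {n} C =
  Maximal C × (∀ i j → C i j ≡ false →
    Σ (Fin m) λ i' → Σ (Fin n) λ j' →
      ¬ (i' ≡ i × j' ≡ j) × Blocked (occupy C i j) i' j')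

EvolutionaryStable : ∀ {m n} → Config m n → Set
EvolutionaryStable C =
  Maximal C × ResistantToPredators C × ResistantToAltruists C

{-# OPTIONS --safe #-}
module Submission where

-- Count the vacant lots of each row.  A vacancy in row r + 2 can be charged injectively
-- to a vacancy of row r in the same or a neighbouring column (two charges meeting at
-- one lot would block the house between them in row r + 1), so no pair of consecutive
-- rows has more vacancies than the two top rows.  In the two top rows every vacancy of
-- row 1 owns a private full column beside it (there is nothing above it to block), and
-- consecutive vacancies of row 2 are separated by a full column; this gives
-- 3 (e₁ + e₂) ≤ 2n − 3.  Above the full bottom row, every interior full column of rows
-- m − 2, m − 1 has a vacancy of each of these rows beside it, so
-- 3 (e_{m−2} + e_{m−1}) ≥ 2n − 3, and a house at (m − 1, 2) or (m − 1, n − 1) forces a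
-- vacancy in row m − 2 that no full column claims, which raises the bound to 2n − 2:
-- a contradiction.

open import Defs
open import Data.Bool using (Bool; true; false; _∧_; _∨_; not; if_then_else_)
open import Data.Bool.Properties using (T-≡; ∧-zeroʳ; ∧-comm; ∧-conicalˡ; ∧-conicalʳ; ¬-not)
open import Data.Empty using (⊥; ⊥-elim)
open import Data.Fin using (Fin; toℕ; _≟_)
import Data.Fin as Fin
open import Data.Fin.Properties using (toℕ-injective; toℕ<n)
open import Data.Maybe using (Maybe; just; nothing; maybe′; fromMaybe; _>>=_)
open import Data.Maybe.Properties using (just-injective)
open import Data.Nat using (ℕ; zero; suc; _+_; _*_; _∸_; _≤_; _<_; _>_; _<ᵇ_; z≤n; s≤s; z<s; pred)
import Data.Nat as ℕ
open import Data.Nat.Properties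
  using (≤-refl; ≤-reflexive; ≤-trans; <⇒≤; <⇒≢; <-irrefl; <⇒≱; <⇒<ᵇ; <ᵇ⇒<; n≤1+n; m≤m+n; m≤n+m; m<n+m;
         pred[n]≤n; m∸n≤m; m+[n∸m]≡n; suc-injective; 1+n≢n; 1+n≢0; +-assoc; +-comm; +-identityʳ;
         +-mono-≤; +-monoˡ-≤; +-monoʳ-≤; *-monoʳ-≤; +-cancelˡ-≤; +-commutativeSemigroup; module ≤-Reasoning)
open import Data.Nat.Solver using (module +-*-Solver)
open import Algebra.Properties.CommutativeSemigroup +-commutativeSemigroup using (interchange)
open import Data.Product using (Σ; ∃; _×_; _,_; proj₁; proj₂)
open import Data.Product.Properties using (≡-dec)
open import Data.Sum using (_⊎_; inj₁; inj₂)
open import Function using (_∘_)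
open import Function.Bundles using (Equivalence)
open import Relation.Binary.PropositionalEquality
  using (_≡_; _≢_; refl; sym; trans; cong; cong₂; subst; subst₂; module ≡-Reasoning)
open import Relation.Nullary using (¬_; Dec; yes; no)

-- Finite sums and double counting

∑ : ℕ → (ℕ → ℕ) → ℕ
∑ zero    f = 0
∑ (suc L) f = f 0 + ∑ L (f ∘ suc)

syntax ∑ L (λ c → e) = ∑[ c < L ] e

⟦_⟧ : Bool → ℕ
⟦ b ⟧ = if b then 1 else 0

∑-mono : ∀ L {f g : ℕ → ℕ} → (∀ c → f c ≤ g c) → ∑ L f ≤ ∑ L g
∑-mono zero    f≤g = z≤n
∑-mono (suc L) f≤g = +-mono-≤ (f≤g 0) (∑-mono L (f≤g ∘ suc))

∑-cong : ∀ L {f g : ℕ → ℕ} → (∀ c → f c ≡ g c) → ∑ L f ≡ ∑ L g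
∑-cong zero    f≡g = refl
∑-cong (suc L) f≡g = cong₂ _+_ (f≡g 0) (∑-cong L (f≡g ∘ suc))

∑-distrib-+ : ∀ L (f g : ℕ → ℕ) → ∑[ c < L ] (f c + g c) ≡ ∑ L f + ∑ L g
∑-distrib-+ zero    f g = refl
∑-distrib-+ (suc L) f g = trans (cong (f 0 + g 0 +_) (∑-distrib-+ L (f ∘ suc) (g ∘ suc)))
                                (interchange (f 0) (g 0) _ _)

∑-snoc : ∀ L (f : ℕ → ℕ) → ∑ (suc L) f ≡ ∑ L f + f L
∑-snoc zero    f = +-identityʳ (f 0)
∑-snoc (suc L) f = trans (cong (f 0 +_) (∑-snoc L (f ∘ suc))) (sym (+-assoc (f 0) _ _))

∑-extend : ∀ L {f : ℕ → ℕ} → f L ≡ 0 → ∑ (suc L) f ≡ ∑ L f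
∑-extend L {f} fL = trans (∑-snoc L f) (trans (cong (∑ L f +_) fL) (+-identityʳ _))

∑-shift-≤ : ∀ L {f : ℕ → ℕ} → f 0 ≡ 0 → ∑ L f ≤ ∑ L (f ∘ suc)
∑-shift-≤ zero    f0 = z≤n
∑-shift-≤ (suc L) {f} f0 rewrite f0 | ∑-snoc L (f ∘ suc) = m≤m+n _ (f (suc L))

∑-shift : ∀ L {f : ℕ → ℕ} → f 0 ≡ 0 → f L ≡ 0 → ∑ L (f ∘ suc) ≡ ∑ L f
∑-shift L {f} f0 fL = begin
  ∑ L (f ∘ suc)   ≡⟨ cong (_+ ∑ L (f ∘ suc)) (sym f0) ⟩
  ∑ (suc L) f     ≡⟨ ∑-extend L fL ⟩
  ∑ L f           ∎
  where open ≡-Reasoning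

∑-term : ∀ {L c} (f : ℕ → ℕ) → c < L → f c ≤ ∑ L f
∑-term {suc L} {zero}  f _         = m≤m+n (f 0) _
∑-term {suc L} {suc c} f (s≤s c<L) = ≤-trans (∑-term (f ∘ suc) c<L) (m≤n+m _ (f 0))

-- Double counting: each source j spreads a j over the targets j, 1 + j and 2 + j (in the
-- amounts c₀ j, c₁ j, c₂ j), and no target k receives more than b k.
∑-charge : ∀ L {a b c₀ c₁ c₂ : ℕ → ℕ} →
  (∀ j → a j ≤ c₀ j + c₁ j + c₂ j) →
  (∀ k → c₀ (2 + k) + c₁ (1 + k) + c₂ k ≤ b (2 + k)) →
  c₀ 0 ≡ 0 → c₀ 1 ≡ 0 → c₁ 0 ≡ 0 → b L ≡ 0 → b (1 + L) ≡ 0 →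
  ∑ L a ≤ ∑ L b
∑-charge L {a} {b} {c₀} {c₁} {c₂} spread land c₀0 c₀1 c₁0 bL bL+1 = begin
  ∑ L a                                                   ≤⟨ ∑-mono L spread ⟩
  ∑[ j < L ] (c₀ j + c₁ j + c₂ j)                          ≡⟨ split c₀ c₁ c₂ ⟩
  ∑ L c₀ + ∑ L c₁ + ∑ L c₂                                 ≤⟨ +-mono-≤ (+-mono-≤ shift₂ (∑-shift-≤ L c₁0)) ≤-refl ⟩
  ∑[ k < L ] c₀ (2 + k) + ∑[ k < L ] c₁ (1 + k) + ∑ L c₂  ≡⟨ sym (split (c₀ ∘ suc ∘ suc) (c₁ ∘ suc) c₂) ⟩
  ∑[ k < L ] (c₀ (2 + k) + c₁ (1 + k) + c₂ k)              ≤⟨ ∑-mono L land ⟩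
  ∑[ k < L ] b (2 + k)                                     ≤⟨ m≤n+m _ (b 0 + b 1) ⟩
  b 0 + b 1 + ∑[ k < L ] b (2 + k)                         ≡⟨ +-assoc (b 0) (b 1) _ ⟩
  ∑ (2 + L) b                                              ≡⟨ trans (∑-extend (suc L) {b} bL+1) (∑-extend L {b} bL) ⟩
  ∑ L b                                                    ∎
  where
  open ≤-Reasoning
  split : ∀ f g h → ∑[ j < L ] (f j + g j + h j) ≡ ∑ L f + ∑ L g + ∑ L h
  split f g h = trans (∑-distrib-+ L _ h) (cong (_+ ∑ L h) (∑-distrib-+ L f g))
  shift₂ : ∑ L c₀ ≤ ∑[ k < L ] c₀ (2 + k)
  shift₂ = ≤-trans (∑-shift-≤ L c₀0) (∑-shift-≤ L c₀1)

charges-≤ : ∀ {x y z t : Bool} →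
  (x ≡ true → t ≡ true) → (y ≡ true → t ≡ true) → (z ≡ true → t ≡ true) →
  (x ≡ true → y ≡ true → ⊥) → (x ≡ true → z ≡ true → ⊥) → (y ≡ true → z ≡ true → ⊥) →
  ⟦ x ⟧ + ⟦ y ⟧ + ⟦ z ⟧ ≤ ⟦ t ⟧
charges-≤ {false} {false} {false}     _  _  _  _   _   _   = z≤n
charges-≤ {true}  {false} {false} {t} xt _  _  _   _   _   rewrite xt refl = ≤-refl
charges-≤ {false} {true}  {false} {t} _  yt _  _   _   _   rewrite yt refl = ≤-refl
charges-≤ {false} {false} {true}  {t} _  _  zt _   _   _   rewrite zt refl = ≤-refl
charges-≤ {true}  {true}              _  _  _  x∦y _   _   = ⊥-elim (x∦y refl refl)
charges-≤ {true}  {false} {true}      _  _  _  _   x∦z _   = ⊥-elim (x∦z refl refl)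
charges-≤ {false} {true}  {true}      _  _  _  _   _   y∦z = ⊥-elim (y∦z refl refl)

∧-true : ∀ {a b} → a ∧ b ≡ true → a ≡ true × b ≡ true
∧-true {true} b≡true = refl , b≡true

∧-intro : ∀ {a b} → a ≡ true → b ≡ true → a ∧ b ≡ true
∧-intro refl refl = refl

∧₄-intro : ∀ {a b c d} → a ≡ true → b ≡ true → c ≡ true → d ≡ true → a ∧ b ∧ c ∧ d ≡ true
∧₄-intro refl refl refl refl = refl

∧₄-elim : ∀ {a b c d} → a ∧ b ∧ c ∧ d ≡ true → a ≡ true × b ≡ true × c ≡ true × d ≡ true
∧₄-elim {true} {true} {true} {true} _ = refl , refl , refl , refl

∨-introˡ : ∀ {a b} → a ≡ true → a ∨ b ≡ true
∨-introˡ refl = refl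

∨-introʳ : ∀ {a b} → b ≡ true → a ∨ b ≡ true
∨-introʳ {true}  _ = refl
∨-introʳ {false} b = b

∨-true : ∀ {a b} → a ∨ b ≡ true → a ≡ true ⊎ b ≡ true
∨-true {true}  _ = inj₁ refl
∨-true {false} b = inj₂ b

∨-resolve : ∀ {a b} → a ∨ b ≡ true → a ≡ false → b ≡ true
∨-resolve a∨b refl = a∨b

∨-resolveʳ : ∀ {a b} → a ∨ b ≡ true → b ≡ false → a ≡ true
∨-resolveʳ {true}  _   _    = refl
∨-resolveʳ {false} a∨b refl = a∨b

not-true : ∀ {a} → not a ≡ true → a ≡ false
not-true {false} _ = refl

-- The board indexed by ℕ

data Position (k : ℕ) : ℕ → Set where
  within : (i : Fin k) → Position k (toℕ i)
  beyond : ∀ {x} → k ≤ x → Position k x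

position : ∀ k x → Position k x
position zero    x       = beyond z≤n
position (suc k) zero    = within Fin.zero
position (suc k) (suc x) with position k x
... | within i   = within (Fin.suc i)
... | beyond k≤x = beyond (s≤s k≤x)

_!?_ : ∀ {A : Set} {k} → (Fin k → A) → ℕ → Maybe A
_!?_ {k = zero}  f x       = nothing
_!?_ {k = suc k} f zero    = just (f Fin.zero)
_!?_ {k = suc k} f (suc x) = (f ∘ Fin.suc) !? x

!?-within : ∀ {A : Set} {k} (f : Fin k → A) (i : Fin k) → f !? toℕ i ≡ just (f i)
!?-within f Fin.zero    = refl
!?-within f (Fin.suc i) = !?-within (f ∘ Fin.suc) i

!?-beyond : ∀ {A : Set} {k x} (f : Fin k → A) → k ≤ x → f !? x ≡ nothing
!?-beyond {k = zero}              f _         = refl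
!?-beyond {k = suc k} {x = suc x} f (s≤s k≤x) = !?-beyond (f ∘ Fin.suc) k≤x

-- Lot (i, j) of C is lot C (toℕ i) (suc (toℕ j)): columns are shifted by one so that both
-- horizontal neighbours of every lot have an index in ℕ, and positions off the board are
-- nothing.  Thus house and vacant are both false off the board, and inside n c says that
-- column c is on it.
lot : ∀ {m n} → Config m n → ℕ → ℕ → Maybe Bool
lot C r zero    = nothing
lot C r (suc c) = C !? r >>= λ row → row !? c

house vacant : ∀ {m n} → Config m n → ℕ → ℕ → Bool
house  C r c = fromMaybe false (lot C r c)
vacant C r c = maybe′ not false (lot C r c)

inside : ℕ → ℕ → Bool
inside n zero    = false
inside n (suc c) = c <ᵇ n

interior : ℕ → ℕ → Bool
interior n c = inside n (pred c) ∧ inside n (suc c)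

full interiorFull : ∀ {m n} → Config m n → ℕ → ℕ → Bool
full C r c = house C r c ∧ house C (suc r) c
interiorFull {n = n} C r c = interior n c ∧ full C r c

blockedAt : ∀ {m n} → Config m n → ℕ → ℕ → Bool
blockedAt C r c = house C r (suc c) ∧ house C r c ∧ house C r (2 + c) ∧ house C (suc r) (suc c)

vacancies : ∀ {m n} → Config m n → ℕ → ℕ
vacancies {n = n} C r = ∑[ c < 2 + n ] ⟦ vacant C r c ⟧

inside-suc : ∀ {n c} → c < n → inside n (suc c) ≡ true
inside-suc c<n = Equivalence.to T-≡ (<⇒<ᵇ c<n)

inside-suc⁻¹ : ∀ n c → inside n (suc c) ≡ true → c < n
inside-suc⁻¹ n c c∈ = <ᵇ⇒< c n (Equivalence.from T-≡ c∈)

inside-after : ∀ {n c} → n ≤ c → inside n (suc c) ≡ false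
inside-after z≤n       = refl
inside-after (s≤s n≤c) = inside-after n≤c

inside-pred : ∀ n c → inside n (2 + c) ≡ true → inside n (suc c) ≡ true
inside-pred n c c∈ = inside-suc (<⇒≤ (inside-suc⁻¹ n (suc c) c∈))

module _ {m n : ℕ} (C : Config m n) where

  lot-within : ∀ i j → lot C (toℕ i) (suc (toℕ j)) ≡ just (C i j)
  lot-within i j rewrite !?-within C i = !?-within (C i) j

  lot-beyond-row : ∀ {r c} → m ≤ r → lot C r c ≡ nothing
  lot-beyond-row {r} {zero}  m≤r = refl
  lot-beyond-row {r} {suc c} m≤r = cong (_>>= λ row → row !? c) (!?-beyond C m≤r)

  lot-beyond-column : ∀ {r c} → n ≤ c → lot C r (suc c) ≡ nothing
  lot-beyond-column {r} {c} n≤c with position m r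
  ... | within i   = trans (cong (_>>= λ row → row !? c) (!?-within C i)) (!?-beyond (C i) n≤c)
  ... | beyond m≤r = lot-beyond-row m≤r

  lot-fin : ∀ {r c b} → lot C r (suc c) ≡ just b →
    Σ (Fin m) λ i → Σ (Fin n) λ j → toℕ i ≡ r × toℕ j ≡ c × C i j ≡ b
  lot-fin {r} {c} eq with position m r | position n c
  ... | within i   | within j   = i , j , refl , refl , just-injective (trans (sym (lot-within i j)) eq)
  ... | within i   | beyond n≤c with () ← trans (sym eq) (lot-beyond-column n≤c)
  ... | beyond m≤r | _          with () ← trans (sym eq) (lot-beyond-row m≤r)

  lot-on-board : ∀ r c {b} → lot C r c ≡ just b → r < m × inside n c ≡ true
  lot-on-board r (suc c) eq with lot-fin eq
  ... | i , j , refl , refl , _ = toℕ<n i , inside-suc (toℕ<n j)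

  lot-defined : ∀ r c → r < m → inside n c ≡ true → ∃ λ b → lot C r c ≡ just b
  lot-defined r (suc c) r<m c∈ with position m r | position n c
  ... | within i   | within j   = C i j , lot-within i j
  ... | within i   | beyond n≤c = ⊥-elim (<⇒≱ (inside-suc⁻¹ n c c∈) n≤c)
  ... | beyond m≤r | _          = ⊥-elim (<⇒≱ r<m m≤r)

  house⇒lot : ∀ r c → house C r c ≡ true → lot C r c ≡ just true
  house⇒lot r c h with lot C r c
  ... | just true = refl

  vacant⇒lot : ∀ r c → vacant C r c ≡ true → lot C r c ≡ just false
  vacant⇒lot r c v with lot C r c
  ... | just false = refl

  house-inside : ∀ r c → house C r c ≡ true → inside n c ≡ true
  house-inside r c h = proj₂ (lot-on-board r c (house⇒lot r c h))

  vacant-inside : ∀ r c → vacant C r c ≡ true → inside n c ≡ true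
  vacant-inside r c v = proj₂ (lot-on-board r c (vacant⇒lot r c v))

  house-row : ∀ r c → house C r c ≡ true → r < m
  house-row r c h = proj₁ (lot-on-board r c (house⇒lot r c h))

  vacant-row : ∀ r c → vacant C r c ≡ true → r < m
  vacant-row r c v = proj₁ (lot-on-board r c (vacant⇒lot r c v))

  house⇒¬vacant : ∀ r c → house C r c ≡ true → vacant C r c ≡ false
  house⇒¬vacant r c h with lot C r c
  ... | just true = refl

  vacant⇒¬house : ∀ r c → vacant C r c ≡ true → house C r c ≡ false
  vacant⇒¬house r c v with lot C r c
  ... | just false = refl

  vacant-and-house : ∀ r c → vacant C r c ≡ true → house C r c ≡ true → ⊥
  vacant-and-house r c v h with () ← trans (sym v) (house⇒¬vacant r c h)

  ¬house⇒vacant : ∀ r c → r < m → inside n c ≡ true → house C r c ≡ false → vacant C r c ≡ true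
  ¬house⇒vacant r c r<m c∈ ¬h with lot C r c | lot-defined r c r<m c∈
  ... | just false | _ = refl
  ... | just true  | _ with () ← ¬h

  ¬vacant⇒house : ∀ r c → r < m → inside n c ≡ true → vacant C r c ≡ false → house C r c ≡ true
  ¬vacant⇒house r c r<m c∈ ¬v with lot C r c | lot-defined r c r<m c∈
  ... | just true  | _ = refl
  ... | just false | _ with () ← ¬v

  house-outside : ∀ r c → inside n c ≡ false → house C r c ≡ false
  house-outside r c out with house C r c in h
  ... | false = refl
  ... | true  with () ← trans (sym (house-inside r c h)) out

  vacant-outside : ∀ r c → inside n c ≡ false → vacant C r c ≡ false
  vacant-outside r c out with vacant C r c in v
  ... | false = refl
  ... | true  with () ← trans (sym (vacant-inside r c v)) out

  full-outside : ∀ r c → inside n c ≡ false → full C r c ≡ false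
  full-outside r c out rewrite house-outside r c out = refl

  vacant-off : ∀ r d → vacant C r (suc (d + n)) ≡ false
  vacant-off r d = vacant-outside r (suc (d + n)) (inside-after (m≤n+m n d))

  full-off : ∀ r d → full C r (suc (d + n)) ≡ false
  full-off r d = full-outside r (suc (d + n)) (inside-after (m≤n+m n d))

  house-fin : ∀ {r c} → house C r c ≡ true →
    Σ (Fin m) λ i → Σ (Fin n) λ j → toℕ i ≡ r × suc (toℕ j) ≡ c × C i j ≡ true
  house-fin {r} {suc c} h with lot-fin (house⇒lot r (suc c) h)
  ... | i , j , eqi , eqj , Cij = i , j , eqi , cong suc eqj , Cij

  vacant-fin : ∀ {r c} → vacant C r c ≡ true →
    Σ (Fin m) λ i → Σ (Fin n) λ j → toℕ i ≡ r × suc (toℕ j) ≡ c × C i j ≡ false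
  vacant-fin {r} {suc c} v with lot-fin (vacant⇒lot r (suc c) v)
  ... | i , j , eqi , eqj , Cij = i , j , eqi , cong suc eqj , Cij

  house-within : ∀ i j → house C (toℕ i) (suc (toℕ j)) ≡ C i j
  house-within i j = cong (fromMaybe false) (lot-within i j)

∑-inside : ∀ L k → k ≤ L → ∑[ c < suc L ] ⟦ inside k c ⟧ ≡ k
∑-inside L k k≤L = below L k k≤L
  where
  zeros : ∀ L → ∑[ c < L ] 0 ≡ 0
  zeros zero    = refl
  zeros (suc L) = zeros L
  below : ∀ L k → k ≤ L → ∑[ c < L ] ⟦ c <ᵇ k ⟧ ≡ k
  below L       zero    _         = zeros L
  below (suc L) (suc k) (s≤s k≤L) = cong suc (below L k k≤L)

inside-with-right : ∀ n c → inside n (suc c) ∧ inside n c ≡ inside (pred n) c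
inside-with-right zero    zero    = refl
inside-with-right zero    (suc c) = refl
inside-with-right (suc n) zero    = refl
inside-with-right (suc n) (suc c) = shrink c n
  where
  shrink : ∀ c k → (c <ᵇ k) ∧ (c <ᵇ suc k) ≡ (c <ᵇ k)
  shrink zero    zero    = refl
  shrink zero    (suc k) = refl
  shrink (suc c) zero    = refl
  shrink (suc c) (suc k) = shrink c k

inside-with-left : ∀ n c → inside n (pred c) ∧ inside n c ≡ inside (pred n) (pred c)
inside-with-left n zero    = refl
inside-with-left n (suc c) = trans (∧-comm (inside n c) (inside n (suc c))) (inside-with-right n c)

interior-inside : ∀ n c → interior n c ∧ inside n c ≡ inside (pred (pred n)) (pred c)
interior-inside n c = trans (spread (inside n (pred c)) (inside n (suc c)) (inside n c))
                            (trans (cong₂ _∧_ (inside-with-left n c) (inside-with-right n c)) (inside-with-left (pred n) c))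
  where
  spread : ∀ a s b → (a ∧ s) ∧ b ≡ (a ∧ b) ∧ (s ∧ b)
  spread true  true  true  = refl
  spread true  true  false = refl
  spread true  false true  = refl
  spread true  false false = refl
  spread false s     b     = refl

∑-inside-with-right : ∀ n → ∑[ c < 2 + n ] ⟦ inside n (suc c) ∧ inside n c ⟧ ≡ pred n
∑-inside-with-right n = trans (∑-cong (2 + n) (cong ⟦_⟧ ∘ inside-with-right n))
                              (∑-inside (suc n) (pred n) (≤-trans pred[n]≤n (n≤1+n n)))

∑-inside-with-left : ∀ n → ∑[ c < 2 + n ] ⟦ inside n (pred c) ∧ inside n c ⟧ ≡ pred n
∑-inside-with-left n = trans (∑-cong (2 + n) (cong ⟦_⟧ ∘ inside-with-left n)) (∑-inside n (pred n) pred[n]≤n)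

∑-interior : ∀ n → ∑[ c < 2 + n ] ⟦ interior n c ∧ inside n c ⟧ ≡ pred (pred n)
∑-interior n = trans (∑-cong (2 + n) (cong ⟦_⟧ ∘ interior-inside n))
                     (∑-inside n (pred (pred n)) (≤-trans pred[n]≤n pred[n]≤n))

-- Local consequences of stability

blockedAt-houses : ∀ {m n} (C : Config m n) r c → blockedAt C r c ≡ true →
  house C r (suc c) ≡ true × house C r c ≡ true × house C r (2 + c) ≡ true × house C (suc r) (suc c) ≡ true
blockedAt-houses C r c = ∧₄-elim {house C r (suc c)} {house C r c} {house C r (2 + c)} {house C (suc r) (suc c)}

module _ {m n : ℕ} (D : Config m n) where

  blocked⇒blockedAt : ∀ i j → Blocked D i j → blockedAt D (toℕ i) (toℕ j) ≡ true
  blocked⇒blockedAt i j (h , (jw , ejw , hw) , (je , eje , he) , (is , eis , hs)) = ∧₄-intro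
    (trans (house-within D i j) h)
    (subst (λ c → house D (toℕ i) c ≡ true) ejw (trans (house-within D i jw) hw))
    (subst (λ c → house D (toℕ i) (suc c) ≡ true) eje (trans (house-within D i je) he))
    (subst (λ r → house D r (suc (toℕ j)) ≡ true) eis (trans (house-within D is j) hs))

  blockedAt⇒blocked : ∀ i j → blockedAt D (toℕ i) (toℕ j) ≡ true → Blocked D i j
  blockedAt⇒blocked i j b with blockedAt-houses D (toℕ i) (toℕ j) b
  ... | h , hw , he , hs = trans (sym (house-within D i j)) h , west , east , south
    where
    west : Σ (Fin n) λ jw → suc (toℕ jw) ≡ toℕ j × D i jw ≡ true
    west with house-fin D hw
    ... | i′ , jw , eqi , eqj , Dw with refl ← toℕ-injective {i = i′} {j = i} eqi = jw , eqj , Dw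
    east : Σ (Fin n) λ je → toℕ je ≡ suc (toℕ j) × D i je ≡ true
    east with house-fin D he
    ... | i′ , je , eqi , eqj , De with refl ← toℕ-injective {i = i′} {j = i} eqi = je , suc-injective eqj , De
    south : Σ (Fin m) λ is → toℕ is ≡ suc (toℕ i) × D is j ≡ true
    south with house-fin D hs
    ... | is , j′ , eqi , eqj , Ds with refl ← toℕ-injective {i = j′} {j = j} (suc-injective eqj) = is , eqi , Ds

module _ {m n : ℕ} (C : Config m n) (i : Fin m) (j : Fin n) where

  occupy-elsewhere : ∀ i′ j′ → (i′ , j′) ≢ (i , j) → occupy C i j i′ j′ ≡ C i′ j′
  occupy-elsewhere i′ j′ ne with i′ ≟ i | j′ ≟ j
  ... | yes refl | yes refl = ⊥-elim (ne refl)
  ... | yes refl | no _     = refl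
  ... | no _     | _        = refl

  lot-occupy : ∀ r c → (r , c) ≢ (toℕ i , suc (toℕ j)) → lot (occupy C i j) r c ≡ lot C r c
  lot-occupy r zero    ne = refl
  lot-occupy r (suc c) ne with position m r | position n c
  ... | within i′ | within j′ = begin
    lot (occupy C i j) (toℕ i′) (suc (toℕ j′))  ≡⟨ lot-within (occupy C i j) i′ j′ ⟩
    just (occupy C i j i′ j′)                    ≡⟨ cong just (occupy-elsewhere i′ j′ λ { refl → ne refl }) ⟩
    just (C i′ j′)                               ≡⟨ sym (lot-within C i′ j′) ⟩
    lot C (toℕ i′) (suc (toℕ j′))                ∎
    where open ≡-Reasoning
  ... | within _   | beyond n≤c = trans (lot-beyond-column (occupy C i j) n≤c) (sym (lot-beyond-column C n≤c))
  ... | beyond m≤r | _          = trans (lot-beyond-row (occupy C i j) m≤r) (sym (lot-beyond-row C m≤r))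

  house-occupied : ∀ r c → house (occupy C i j) r c ≡ true → (r , c) ≢ (toℕ i , suc (toℕ j)) → house C r c ≡ true
  house-occupied r c h ne = trans (cong (fromMaybe false) (sym (lot-occupy r c ne))) h

_≟₂_ : (p q : ℕ × ℕ) → Dec (p ≡ q)
_≟₂_ = ≡-dec ℕ._≟_ ℕ._≟_

other-lot : ∀ {m n} {i i′ : Fin m} {j j′ : Fin n} → ¬ (i′ ≡ i × j′ ≡ j) →
  (toℕ i′ , suc (toℕ j′)) ≢ (toℕ i , suc (toℕ j))
other-lot ne eq = ne (toℕ-injective (cong proj₁ eq) , toℕ-injective (suc-injective (cong proj₂ eq)))

module _ {m n : ℕ} {C : Config m n} where

  house-not-blocked : Permissible C → ∀ r c → house C r (suc c) ≡ true → house C r c ≡ true →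
    house C r (2 + c) ≡ true → house C (suc r) (suc c) ≡ true → ⊥
  house-not-blocked perm r c h hw he hs with house-fin C {r} {suc c} h
  ... | i , j , refl , eqj , _ with refl ← suc-injective eqj =
    perm i j (blockedAt⇒blocked C i j (∧₄-intro h hw he hs))

  vacant-surrounded : ResistantToPredators C → ∀ r c → vacant C r (suc c) ≡ true →
    house C r c ≡ true × house C r (2 + c) ≡ true × house C (suc r) (suc c) ≡ true
  vacant-surrounded rp r c v with vacant-fin C {r} {suc c} v
  ... | i , j , refl , eqj , Cij with refl ← suc-injective eqj
    with blockedAt-houses (occupy C i j) (toℕ i) (toℕ j) (blocked⇒blockedAt (occupy C i j) i j (proj₂ rp i j Cij))
  ... | _ , hw , he , hs =
      house-occupied C i j (toℕ i) (toℕ j) hw (λ eq → 1+n≢n (sym (cong proj₂ eq)))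
    , house-occupied C i j (toℕ i) (2 + toℕ j) he (λ eq → 1+n≢n (suc-injective (cong proj₂ eq)))
    , house-occupied C i j (suc (toℕ i)) (suc (toℕ j)) hs (λ eq → 1+n≢n (cong proj₁ eq))

  module _ (perm : Permissible C) (i : Fin m) (j : Fin n) where

    private
      old = house-occupied C i j

    occupying-blocks-neighbour : ∀ r c → blockedAt (occupy C i j) r c ≡ true → (r , suc c) ≢ (toℕ i , suc (toℕ j)) →
        (r ≡ toℕ i × c ≡ suc (toℕ j) × house C r (2 + c) ∧ house C (suc r) (suc c) ≡ true)
      ⊎ (r ≡ toℕ i × 2 + c ≡ suc (toℕ j) × house C r c ∧ house C (suc r) (suc c) ≡ true)
      ⊎ (suc r ≡ toℕ i × c ≡ toℕ j × house C r c ∧ house C r (2 + c) ≡ true)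
    occupying-blocks-neighbour r c bl centre≢ with blockedAt-houses (occupy C i j) r c bl
    ... | h , hw , he , hs with (r , c) ≟₂ new | (r , 2 + c) ≟₂ new | (suc r , suc c) ≟₂ new
      where new = (toℕ i , suc (toℕ j))
    ... | yes refl | _ | _ = inj₁ (refl , refl , ∧-intro
            (old r (2 + c) he λ eq → <⇒≢ (m<n+m c {2} z<s) (sym (cong proj₂ eq)))
            (old (suc r) (suc c) hs λ eq → 1+n≢n (cong proj₁ eq)))
    ... | no _ | yes e | _ = inj₂ (inj₁ (cong proj₁ e , cong proj₂ e , ∧-intro
            (old r c hw λ eq → <⇒≢ (m<n+m c {2} z<s) (trans (cong proj₂ eq) (sym (cong proj₂ e))))
            (old (suc r) (suc c) hs λ eq → 1+n≢n (trans (cong proj₁ eq) (sym (cong proj₁ e))))))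
    ... | no _ | no _ | yes s = inj₂ (inj₂ (cong proj₁ s , suc-injective (cong proj₂ s) , ∧-intro
            (old r c hw λ eq → 1+n≢n (trans (cong proj₁ s) (sym (cong proj₁ eq))))
            (old r (2 + c) he λ eq → 1+n≢n (trans (cong proj₁ s) (sym (cong proj₁ eq))))))
    ... | no w | no e | no s = ⊥-elim (house-not-blocked perm r c
            (old r (suc c) h centre≢) (old r c hw w) (old r (2 + c) he e) (old (suc r) (suc c) hs s))

  top-vacant-private : ResistantToAltruists C → ∀ c → vacant C 0 (2 + c) ≡ true →
    (house C 0 c ∧ house C 1 (1 + c)) ∨ (house C 0 (4 + c) ∧ house C 1 (3 + c)) ≡ true
  top-vacant-private ra c v with vacant-fin C {0} {2 + c} v
  ... | i , j , ei , ej , Cij with proj₂ ra i j Cij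
  ... | i′ , j′ , ne , bl
    with occupying-blocks-neighbour (proj₁ (proj₁ ra)) i j (toℕ i′) (toℕ j′)
           (blocked⇒blockedAt (occupy C i j) i′ j′ bl) (other-lot ne)
  ... | inj₁ (r≡ , c≡ , hs) = ∨-introʳ (subst₂ (λ r q → house C r (2 + q) ∧ house C (suc r) (suc q) ≡ true)
                                          (trans r≡ ei) (trans c≡ ej) hs)
  ... | inj₂ (inj₁ (r≡ , c≡ , hs)) = ∨-introˡ (subst₂ (λ r q → house C r q ∧ house C (suc r) (suc q) ≡ true)
                                          (trans r≡ ei) (suc-injective (suc-injective (trans c≡ ej))) hs)
  ... | inj₂ (inj₂ (r≡ , _)) = ⊥-elim (1+n≢0 (trans r≡ ei))

  house-with-house-below : Permissible C → ∀ r c → house C r (suc c) ≡ true → house C (suc r) (suc c) ≡ true →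
    inside n c ≡ true → inside n (2 + c) ≡ true → vacant C r c ∨ vacant C r (2 + c) ≡ true
  house-with-house-below perm r c h hs c∈ 2+c∈ with house C r c in hw | house C r (2 + c) in he
  ... | true  | true  = ⊥-elim (house-not-blocked perm r c h hw he hs)
  ... | false | _     = ∨-introˡ (¬house⇒vacant C r c (house-row C r (suc c) h) c∈ hw)
  ... | true  | false = ∨-introʳ (¬house⇒vacant C r (2 + c) (house-row C r (suc c) h) 2+c∈ he)

module _ {m n : ℕ} {C : Config m n} (rp : ResistantToPredators C) where

  vacant-below : ∀ r c → vacant C r c ≡ true → house C (suc r) c ≡ true
  vacant-below r (suc c) v = proj₂ (proj₂ (vacant-surrounded rp r c v))

  vacant-above : ∀ r c → vacant C (suc r) c ≡ true → house C r c ≡ true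
  vacant-above r c v with vacant C r c in v′
  ... | false = ¬vacant⇒house C r c (<⇒≤ (vacant-row C (suc r) c v)) (vacant-inside C (suc r) c v) v′
  ... | true  with () ← trans (sym (vacant-below r c v′)) (vacant⇒¬house C (suc r) c v)

  vacant-interior : ∀ r c → vacant C r c ≡ true → interior n c ≡ true
  vacant-interior r (suc c) v with vacant-surrounded rp r c v
  ... | hw , he , _ = ∧-intro (house-inside C r c hw) (house-inside C r (2 + c) he)

  vacant-first-column : ∀ r → vacant C r 1 ≡ false
  vacant-first-column r with vacant C r 1 in v
  ... | false = refl
  ... | true  with () ← proj₁ (vacant-surrounded rp r 0 v)

  vacant-last-column : ∀ r c → inside n (2 + c) ≡ false → vacant C r (suc c) ≡ false
  vacant-last-column r c out with vacant C r (suc c) in v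
  ... | false = refl
  ... | true  with () ← trans (sym (house-inside C r (2 + c) (proj₁ (proj₂ (vacant-surrounded rp r c v))))) out

  no-adjacent-vacancies : ∀ r c → vacant C r c ≡ true → vacant C r (suc c) ≡ true → ⊥
  no-adjacent-vacancies r (suc c) v v′ = vacant-and-house C r (2 + c) v′ (proj₁ (proj₂ (vacant-surrounded rp r c v)))

  bottom-house : ∀ r c → suc r ≡ m → inside n c ≡ true → house C r c ≡ true
  bottom-house r c bottom c∈ with vacant C r c in v
  ... | false = ¬vacant⇒house C r c (subst (r <_) bottom ≤-refl) c∈ v
  ... | true  with suc c′ ← c =
    ⊥-elim (<-irrefl bottom (house-row C (suc r) (suc c′) (proj₂ (proj₂ (vacant-surrounded rp r c′ v)))))

-- Counting vacancies

module _ {m n : ℕ} {C : Config m n} (rp : ResistantToPredators C) where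

  private
    perm : Permissible C
    perm = proj₁ (proj₁ rp)

  column-partition : ∀ r c (w : Bool) → suc r < m →
    (vacant C r c ≡ true → w ≡ true) → (vacant C (suc r) c ≡ true → w ≡ true) →
    ⟦ w ∧ inside n c ⟧ ≡ ⟦ vacant C r c ⟧ + ⟦ vacant C (suc r) c ⟧ + ⟦ w ∧ full C r c ⟧
  column-partition r c w below vw vw′ with vacant C r c in v | vacant C (suc r) c in v′
  ... | true  | true  = ⊥-elim (vacant-and-house C (suc r) c v′ (vacant-below rp r c v))
  ... | true  | false rewrite vw refl | vacant-inside C r c v | vacant⇒¬house C r c v = refl
  ... | false | true  rewrite vw′ refl | vacant-inside C (suc r) c v′ | vacant⇒¬house C (suc r) c v′
                            | vacant-above rp r c v′ = refl
  ... | false | false with inside n c in c∈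
  ...   | true  rewrite ¬vacant⇒house C r c (<⇒≤ below) c∈ v | ¬vacant⇒house C (suc r) c below c∈ v′ = refl
  ...   | false rewrite house-outside C r c c∈ = refl

  rows-partition : ∀ r (w : ℕ → Bool) → suc r < m →
    (∀ c → vacant C r c ≡ true → w c ≡ true) → (∀ c → vacant C (suc r) c ≡ true → w c ≡ true) →
    ∑[ c < 2 + n ] ⟦ w c ∧ inside n c ⟧ ≡ vacancies C r + vacancies C (suc r) + ∑[ c < 2 + n ] ⟦ w c ∧ full C r c ⟧
  rows-partition r w below vw vw′ = begin
    ∑[ c < 2 + n ] ⟦ w c ∧ inside n c ⟧
      ≡⟨ ∑-cong (2 + n) (λ c → column-partition r c (w c) below (vw c) (vw′ c)) ⟩
    ∑[ c < 2 + n ] (⟦ vacant C r c ⟧ + ⟦ vacant C (suc r) c ⟧ + ⟦ w c ∧ full C r c ⟧)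
      ≡⟨ ∑-distrib-+ (2 + n) (λ c → ⟦ vacant C r c ⟧ + ⟦ vacant C (suc r) c ⟧) (λ c → ⟦ w c ∧ full C r c ⟧) ⟩
    ∑[ c < 2 + n ] (⟦ vacant C r c ⟧ + ⟦ vacant C (suc r) c ⟧) + ∑[ c < 2 + n ] ⟦ w c ∧ full C r c ⟧
      ≡⟨ cong (_+ ∑[ c < 2 + n ] ⟦ w c ∧ full C r c ⟧)
              (∑-distrib-+ (2 + n) (λ c → ⟦ vacant C r c ⟧) (λ c → ⟦ vacant C (suc r) c ⟧)) ⟩
    vacancies C r + vacancies C (suc r) + ∑[ c < 2 + n ] ⟦ w c ∧ full C r c ⟧ ∎
    where open ≡-Reasoning

  -- A vacancy of row 2 + r is charged to the lot of row r in its column if that is vacant,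
  -- else to the left neighbour of that lot if vacant, else to its right neighbour: that one
  -- is vacant, as otherwise the house of row r in the vacancy's column would be blocked.
  vacancies[2+r]≤vacancies[r] : ∀ r → 2 + r < m → vacancies C (2 + r) ≤ vacancies C r
  vacancies[2+r]≤vacancies[r] r 2+r<m = begin
    vacancies C (2 + r)                  ≡⟨ sym (∑-shift (2 + n) {λ c → ⟦ V (2 + r) c ⟧} refl (cong ⟦_⟧ (vacant-off C (2 + r) 1))) ⟩
    ∑[ j < 2 + n ] ⟦ V (2 + r) (suc j) ⟧  ≤⟨ ∑-charge (2 + n) {b = λ c → ⟦ V r c ⟧} {c₀} {c₁} {c₂} spread land
                                               refl (first-column _) (first-column _)
                                               (cong ⟦_⟧ (vacant-off C r 1)) (cong ⟦_⟧ (vacant-off C r 2)) ⟩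
    vacancies C r                        ∎
    where
    open ≤-Reasoning
    V = vacant C
    r<m : r < m
    r<m = <⇒≤ (<⇒≤ 2+r<m)
    first-column : ∀ b → ⟦ V r 1 ∧ b ⟧ ≡ 0
    first-column b = cong (λ x → ⟦ x ∧ b ⟧) (vacant-first-column rp r)
    c₀ c₁ c₂ : ℕ → ℕ
    c₀ j = ⟦ V r j ∧ V (2 + r) (suc j) ∧ not (V r (suc j)) ⟧
    c₁ j = ⟦ V r (suc j) ∧ V (2 + r) (suc j) ⟧
    c₂ j = ⟦ V (2 + r) (suc j) ∧ not (V r (suc j)) ∧ not (V r j) ⟧
    spread : ∀ j → ⟦ V (2 + r) (suc j) ⟧ ≤ c₀ j + c₁ j + c₂ j
    spread j = cases (V r j) (V (2 + r) (suc j)) (V r (suc j))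
      where
      cases : ∀ u₀ e u₁ → ⟦ e ⟧ ≤ ⟦ u₀ ∧ e ∧ not u₁ ⟧ + ⟦ u₁ ∧ e ⟧ + ⟦ e ∧ not u₁ ∧ not u₀ ⟧
      cases u₀    false u₁    = z≤n
      cases true  true  false = ≤-refl
      cases false true  false = ≤-refl
      cases false true  true  = s≤s z≤n
      cases true  true  true  = s≤s z≤n
    right-lands : ∀ k → V (2 + r) (suc k) ≡ true → V r (suc k) ≡ false → V r k ≡ false → V r (2 + k) ≡ true
    right-lands k ve u₁ u₀ with vacant-surrounded rp (2 + r) k ve | house C r (2 + k) in h
    ... | _  , he , _ | false = ¬house⇒vacant C r (2 + k) r<m (house-inside C (2 + r) (2 + k) he) h
    ... | hw , _  , _ | true  = ⊥-elim (house-not-blocked perm r k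
            (¬vacant⇒house C r (suc k) r<m (vacant-inside C (2 + r) (suc k) ve) u₁)
            (¬vacant⇒house C r k r<m (house-inside C (2 + r) k hw) u₀)
            h (vacant-above rp (suc r) (suc k) ve))
    land : ∀ k → c₀ (2 + k) + c₁ (1 + k) + c₂ k ≤ ⟦ V r (2 + k) ⟧
    land k = charges-≤ (∧-conicalˡ _ _) (∧-conicalˡ _ _)
      (λ z → let ve , u = ∧-true {V (2 + r) (suc k)} z in
             right-lands k ve (not-true (∧-conicalˡ _ _ u)) (not-true (∧-conicalʳ _ _ u)))
      (λ x y → no-adjacent-vacancies rp (2 + r) (2 + k) (∧-conicalʳ _ _ y) (∧-conicalˡ _ _ (∧-conicalʳ (V r (2 + k)) _ x)))
      (λ x z → house-not-blocked perm (suc r) (1 + k)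
                 (vacant-below rp r (2 + k) (∧-conicalˡ _ _ x))
                 (vacant-above rp (suc r) (1 + k) (∧-conicalˡ _ _ z))
                 (vacant-above rp (suc r) (3 + k) (∧-conicalˡ _ _ (∧-conicalʳ (V r (2 + k)) _ x)))
                 (proj₁ (proj₂ (vacant-surrounded rp (2 + r) k (∧-conicalˡ _ _ z)))))
      (λ y z → no-adjacent-vacancies rp (2 + r) (1 + k) (∧-conicalˡ _ _ z) (∧-conicalʳ (V r (2 + k)) _ y))

  vacancies-pair≤top-pair : ∀ k → suc k < m → vacancies C k + vacancies C (suc k) ≤ vacancies C 0 + vacancies C 1
  vacancies-pair≤top-pair zero    _     = ≤-refl
  vacancies-pair≤top-pair (suc k) 2+k<m = begin
    vacancies C (suc k) + vacancies C (2 + k)  ≤⟨ +-monoʳ-≤ (vacancies C (suc k)) (vacancies[2+r]≤vacancies[r] k 2+k<m) ⟩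
    vacancies C (suc k) + vacancies C k        ≡⟨ +-comm (vacancies C (suc k)) (vacancies C k) ⟩
    vacancies C k + vacancies C (suc k)        ≤⟨ vacancies-pair≤top-pair k (<⇒≤ 2+k<m) ⟩
    vacancies C 0 + vacancies C 1              ∎
    where open ≤-Reasoning

module _ where
  open +-*-Solver

  pair-bound-≤ : ∀ {p q a b x y} → p ≤ a → q ≤ b → p + q + a ≡ x → p + q + b ≡ y → 3 * (p + q) ≤ x + y
  pair-bound-≤ {p} {q} {a} {b} p≤a q≤b refl refl = begin
    3 * (p + q)                ≡⟨ solve 2 (λ p q → con 3 :* (p :+ q) := (p :+ q :+ p) :+ (p :+ q :+ q)) refl p q ⟩
    (p + q + p) + (p + q + q)  ≤⟨ +-mono-≤ (+-monoʳ-≤ (p + q) p≤a) (+-monoʳ-≤ (p + q) q≤b) ⟩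
    (p + q + a) + (p + q + b)  ∎
    where open ≤-Reasoning

  pair-bound-≥ : ∀ {p q a b x y} → b + 1 ≤ p → a ≤ q → p + q + b ≡ x → p + q + a ≡ y → x + y + 1 ≤ 3 * (p + q)
  pair-bound-≥ {p} {q} {a} {b} b+1≤p a≤q refl refl = begin
    (p + q + b) + (p + q + a) + 1    ≡⟨ solve 4 (λ p q a b → (p :+ q :+ b) :+ (p :+ q :+ a) :+ con 1
                                                          := (p :+ q :+ (b :+ con 1)) :+ (p :+ q :+ a)) refl p q a b ⟩
    (p + q + (b + 1)) + (p + q + a)  ≤⟨ +-mono-≤ (+-monoʳ-≤ (p + q) b+1≤p) (+-monoʳ-≤ (p + q) a≤q) ⟩
    (p + q + p) + (p + q + q)        ≡⟨ solve 2 (λ p q → (p :+ q :+ p) :+ (p :+ q :+ q) := con 3 :* (p :+ q)) refl p q ⟩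
    3 * (p + q)                      ∎
    where open ≤-Reasoning

  pred²+pred+3≡2* : ∀ {n} → 2 ≤ n → pred (pred n) + pred n + 3 ≡ 2 * n
  pred²+pred+3≡2* (s≤s (s≤s {n = k} _)) = solve 1 (λ k → k :+ (con 1 :+ k) :+ con 3 := con 2 :* (con 2 :+ k)) refl k

-- The two top rows

module _ {m n : ℕ} {C : Config m n} (rp : ResistantToPredators C) (ra : ResistantToAltruists C) (1<m : 1 < m) where

  private
    V = vacant C
    H = house C
    F = full C 0
    full-off-∧ : ∀ (w : ℕ → Bool) d → ⟦ w (suc (d + n)) ∧ F (suc (d + n)) ⟧ ≡ 0
    full-off-∧ w d = cong ⟦_⟧ (trans (cong (w (suc (d + n)) ∧_) (full-off C 0 d)) (∧-zeroʳ (w (suc (d + n)))))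

  -- A vacancy of the top row is charged to the full column beside it whose top house it
  -- would block (it exists by altruist resistance, as nothing lies above the top row).
  top-vacancies≤interior-full : vacancies C 0 ≤ ∑[ c < 2 + n ] ⟦ interiorFull C 0 c ⟧
  top-vacancies≤interior-full = begin
    vacancies C 0                      ≡⟨ sym (∑-shift (2 + n) {λ c → ⟦ V 0 c ⟧} refl (cong ⟦_⟧ (vacant-off C 0 1))) ⟩
    ∑[ j < 2 + n ] ⟦ V 0 (suc j) ⟧     ≤⟨ ∑-charge (2 + n) {b = λ c → ⟦ interiorFull C 0 c ⟧} {c₀} {λ _ → 0} {c₂}
                                            spread land refl refl refl (full-off-∧ (interior n) 1) (full-off-∧ (interior n) 2) ⟩
    ∑[ c < 2 + n ] ⟦ interiorFull C 0 c ⟧ ∎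
    where
    open ≤-Reasoning
    private-left : ℕ → Bool
    private-left j = H 0 (pred j) ∧ H 1 j
    c₀ c₂ : ℕ → ℕ
    c₀ j = ⟦ private-left j ∧ V 0 (suc j) ⟧
    c₂ j = ⟦ V 0 (suc j) ∧ not (private-left j) ⟧
    spread : ∀ j → ⟦ V 0 (suc j) ⟧ ≤ c₀ j + 0 + c₂ j
    spread j with private-left j | V 0 (suc j)
    ... | _     | false = z≤n
    ... | true  | true  = ≤-refl
    ... | false | true  = ≤-refl
    private-right : ∀ k → V 0 (1 + k) ≡ true → private-left k ≡ false → H 0 (3 + k) ≡ true × H 1 (2 + k) ≡ true
    private-right zero    v _ with () ← trans (sym v) (vacant-first-column rp 0)
    private-right (suc k) v ¬left with ∨-true (top-vacant-private ra k v)
    ... | inj₁ left  with () ← trans (sym left) ¬left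
    ... | inj₂ right = ∧-true right
    interior-full : ∀ k → inside n (1 + k) ≡ true → inside n (3 + k) ≡ true → H 0 (2 + k) ≡ true → H 1 (2 + k) ≡ true →
      interiorFull C 0 (2 + k) ≡ true
    interior-full k a b c d = ∧-intro (∧-intro a b) (∧-intro c d)
    land : ∀ k → c₀ (2 + k) + 0 + c₂ k ≤ ⟦ interiorFull C 0 (2 + k) ⟧
    land k = charges-≤ {y = false}
      (λ x → let h , v₃ = ∧-true {private-left (2 + k)} x in
             interior-full k (house-inside C 0 (1 + k) (∧-conicalˡ _ _ h)) (vacant-inside C 0 (3 + k) v₃)
                           (proj₁ (vacant-surrounded rp 0 (2 + k) v₃)) (∧-conicalʳ _ _ h))
      (λ ())
      (λ z → let v₁ , ¬left = ∧-true {V 0 (1 + k)} z ; h = private-right k v₁ (not-true ¬left) in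
             interior-full k (vacant-inside C 0 (1 + k) v₁) (house-inside C 0 (3 + k) (proj₁ h))
                           (proj₁ (proj₂ (vacant-surrounded rp 0 k v₁))) (proj₂ h))
      (λ _ ())
      (λ x z → let v₁ , ¬left = ∧-true {V 0 (1 + k)} z in
               vacant-and-house C 0 (3 + k) (∧-conicalʳ (private-left (2 + k)) _ x)
                                (proj₁ (private-right k v₁ (not-true ¬left))))
      (λ ())

  -- A vacancy of the second row is charged to the next column if that is full, and otherwise
  -- (the next column then has a top vacancy) to the private full column of that top vacancy.
  second-vacancies≤full-with-left : vacancies C 1 ≤ ∑[ c < 2 + n ] ⟦ inside n (pred c) ∧ F c ⟧
  second-vacancies≤full-with-left =
    ∑-charge (2 + n) {b = λ c → ⟦ inside n (pred c) ∧ F c ⟧} {λ _ → 0} {c₁} {c₂} spread land refl refl refl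
      (full-off-∧ (inside n ∘ pred) 1) (full-off-∧ (inside n ∘ pred) 2)
    where
    c₁ c₂ : ℕ → ℕ
    c₁ j = ⟦ V 1 j ∧ F (suc j) ⟧
    c₂ j = ⟦ V 1 j ∧ not (F (suc j)) ⟧
    spread : ∀ j → ⟦ V 1 j ⟧ ≤ 0 + c₁ j + c₂ j
    spread j with V 1 j | F (suc j)
    ... | false | _     = z≤n
    ... | true  | true  = ≤-refl
    ... | true  | false = ≤-refl
    top-vacant-next : ∀ k → V 1 (suc k) ≡ true → F (2 + k) ≡ false → V 0 (2 + k) ≡ true
    top-vacant-next k v ¬full with house C 0 (2 + k) in h₀
    ... | true  with () ← trans (sym ¬full) (cong (true ∧_) (proj₁ (proj₂ (vacant-surrounded rp 1 k v))))
    ... | false = ¬house⇒vacant C 0 (2 + k) (<⇒≤ 1<m)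
                    (house-inside C 1 (2 + k) (proj₁ (proj₂ (vacant-surrounded rp 1 k v)))) h₀
    full-after-next : ∀ k → V 1 k ≡ true → F (1 + k) ≡ false → inside n (1 + k) ∧ F (2 + k) ≡ true
    full-after-next (suc k) v ¬full = from-private (top-vacant-next k v ¬full)
      where
      from-private : V 0 (2 + k) ≡ true → inside n (2 + k) ∧ F (3 + k) ≡ true
      from-private v₀ with ∨-true (top-vacant-private ra k v₀)
      ... | inj₁ left  = ⊥-elim (vacant-and-house C 1 (suc k) v (∧-conicalʳ (H 0 k) _ left))
      ... | inj₂ right = ∧-intro (vacant-inside C 0 (2 + k) v₀)
                                 (∧-intro (proj₁ (proj₂ (vacant-surrounded rp 0 (suc k) v₀))) (∧-conicalʳ _ _ right))
    land : ∀ k → 0 + c₁ (1 + k) + c₂ k ≤ ⟦ inside n (1 + k) ∧ F (2 + k) ⟧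
    land k = charges-≤ {x = false} (λ ())
      (λ y → let v , f = ∧-true {V 1 (1 + k)} y in ∧-intro (vacant-inside C 1 (1 + k) v) f)
      (λ z → let v , ¬f = ∧-true {V 1 k} z in full-after-next k v (not-true ¬f))
      (λ ()) (λ ())
      (λ y z → no-adjacent-vacancies rp 1 k (∧-conicalˡ _ _ z) (∧-conicalˡ _ _ y))

  top-rows-vacancy-bound : 2 ≤ n → 3 * (vacancies C 0 + vacancies C 1) + 3 ≤ 2 * n
  top-rows-vacancy-bound 2≤n = begin
    3 * (vacancies C 0 + vacancies C 1) + 3
      ≤⟨ +-monoˡ-≤ 3 (pair-bound-≤ top-vacancies≤interior-full second-vacancies≤full-with-left
                        (trans (sym (rows-partition rp 0 (interior n) 1<m (vacant-interior rp 0) (vacant-interior rp 1)))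
                               (∑-interior n))
                        (trans (sym (rows-partition rp 0 (inside n ∘ pred) 1<m
                                       (λ c → ∧-conicalˡ _ _ ∘ vacant-interior rp 0 c)
                                       (λ c → ∧-conicalˡ _ _ ∘ vacant-interior rp 1 c)))
                               (∑-inside-with-left n))) ⟩
    pred (pred n) + pred n + 3  ≡⟨ pred²+pred+3≡2* 2≤n ⟩
    2 * n                       ∎
    where open ≤-Reasoning

-- The two rows above the bottom row

flanked unflanked : ∀ {m n} → Config m n → ℕ → ℕ → Bool
flanked   C r c = vacant C r c ∧ (interiorFull C r (pred c) ∨ interiorFull C r (suc c))
unflanked C r c = vacant C r c ∧ not (interiorFull C r (pred c) ∨ interiorFull C r (suc c))

module _ {m n : ℕ} {C : Config m n} (rp : ResistantToPredators C) (up : ℕ) (bottom : 3 + up ≡ m) where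

  private
    perm : Permissible C
    perm = proj₁ (proj₁ rp)
    low = suc up
    V = vacant C
    H = house C
    F = full C up
    up<m : up < m
    up<m = subst (up <_) bottom (s≤s (m≤n+m up 2))
    low<m : low < m
    low<m = subst (low <_) bottom (s≤s (s≤s (m≤n+m up 1)))

  low-house-sides : ∀ c → H low (suc c) ≡ true → inside n c ≡ true → inside n (2 + c) ≡ true →
    V low c ∨ V low (2 + c) ≡ true
  low-house-sides c h c∈ 2+c∈ =
    house-with-house-below perm low c h (bottom-house rp (suc low) (suc c) bottom (house-inside C low (suc c) h)) c∈ 2+c∈

  full-sides : ∀ c → F (suc c) ≡ true → inside n c ≡ true → inside n (2 + c) ≡ true →
    V low c ∨ V low (2 + c) ≡ true × V up c ∨ V up (2 + c) ≡ true
  full-sides c f c∈ 2+c∈ = let hu , hl = ∧-true f in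
    low-house-sides c hl c∈ 2+c∈ , house-with-house-below perm up c hu hl c∈ 2+c∈

  both-vacant : ∀ c → V up c ≡ true → V low c ≡ true → ⊥
  both-vacant c vu vl = vacant-and-house C low c vl (vacant-below rp up c vu)

  full⇒¬vacant-low : ∀ c → F c ≡ true → V low c ≡ false
  full⇒¬vacant-low c f = house⇒¬vacant C low c (∧-conicalʳ (H up c) _ f)

  full⇒¬vacant-up : ∀ c → F c ≡ true → V up c ≡ false
  full⇒¬vacant-up c f = house⇒¬vacant C up c (∧-conicalˡ _ _ f)

  full-beside-full : ∀ c → F (suc c) ≡ true → inside n c ≡ true → inside n (2 + c) ≡ true →
    F c ≡ true ⊎ F (2 + c) ≡ true → ⊥
  full-beside-full c f c∈ 2+c∈ beside with full-sides c f c∈ 2+c∈ | beside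
  ... | vl , vu | inj₁ f′ =
    both-vacant (2 + c) (∨-resolve vu (full⇒¬vacant-up c f′)) (∨-resolve vl (full⇒¬vacant-low c f′))
  ... | vl , vu | inj₂ f′ =
    both-vacant c (∨-resolveʳ vu (full⇒¬vacant-up (2 + c) f′)) (∨-resolveʳ vl (full⇒¬vacant-low (2 + c) f′))

  no-adjacent-full : 3 ≤ n → ∀ c → F c ≡ true → F (suc c) ≡ true → ⊥
  no-adjacent-full 3≤n (suc c) f f′ with inside n (3 + c) in 3+c∈
  ... | true  = full-beside-full (suc c) f′ (house-inside C up (suc c) (∧-conicalˡ _ _ f)) 3+c∈ (inj₁ f)
  ... | false = at-edge c f f′ 3+c∈
    where
    at-edge : ∀ c → F (suc c) ≡ true → F (2 + c) ≡ true → inside n (3 + c) ≡ false → ⊥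
    at-edge zero    _ _  3∉ with () ← trans (sym (inside-suc 3≤n)) 3∉
    at-edge (suc c) f f′ _  = full-beside-full (suc c) f (inside-pred n c (house-inside C up (2 + c) (∧-conicalˡ _ _ f)))
                                (house-inside C up (3 + c) (∧-conicalˡ _ _ f′)) (inj₂ f′)

  vacant-between-full : ∀ c → V up (suc c) ≡ true → F c ≡ true → F (2 + c) ≡ true →
    inside n c ≡ true → inside n (2 + c) ≡ true → ⊥
  vacant-between-full c v f₀ f₂ c∈ 2+c∈ =
    vacant-and-house C low (2 + c)
      (∨-resolve (low-house-sides c (vacant-below rp up (suc c) v) c∈ 2+c∈) (full⇒¬vacant-low c f₀))
      (∧-conicalʳ (H up (2 + c)) _ f₂)

  -- A full column is charged to the next column if that has a lower vacancy; otherwise the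
  -- next column has an upper vacancy, whose lower neighbour needs a lower vacancy beside it,
  -- and the charge goes to the column after.
  full-with-right≤low-vacancies : 3 ≤ n → ∑[ c < 2 + n ] ⟦ inside n (suc c) ∧ F c ⟧ ≤ vacancies C low
  full-with-right≤low-vacancies 3≤n =
    ∑-charge (2 + n) {b = λ c → ⟦ V low c ⟧} {λ _ → 0} {c₁} {c₂} spread land refl refl
      (cong (λ x → ⟦ x ∧ (inside n 1 ∧ F 0) ⟧) (vacant-first-column rp low))
      (cong ⟦_⟧ (vacant-off C low 1)) (cong ⟦_⟧ (vacant-off C low 2))
    where
    c₁ c₂ : ℕ → ℕ
    c₁ j = ⟦ V low (suc j) ∧ (inside n (suc j) ∧ F j) ⟧
    c₂ j = ⟦ not (V low (suc j)) ∧ (inside n (suc j) ∧ F j) ⟧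
    spread : ∀ j → ⟦ inside n (suc j) ∧ F j ⟧ ≤ 0 + c₁ j + c₂ j
    spread j with inside n (suc j) ∧ F j | V low (suc j)
    ... | false | _     = z≤n
    ... | true  | true  = ≤-refl
    ... | true  | false = ≤-refl
    second-lands : ∀ k → V low (suc k) ≡ false → inside n (suc k) ≡ true → F k ≡ true → V low (2 + k) ≡ true
    second-lands k ¬vl c∈ fk with H up (suc k) in hu | ¬vacant⇒house C low (suc k) low<m c∈ ¬vl
    ... | true  | hl = ⊥-elim (no-adjacent-full 3≤n k fk (∧-intro hu hl))
    ... | false | hl = ∨-resolve (low-house-sides k hl (house-inside C up k (∧-conicalˡ _ _ fk))
                                   (house-inside C up (2 + k) (proj₁ (proj₂ (vacant-surrounded rp up k vu)))))
                                 (full⇒¬vacant-low k fk)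
      where vu = ¬house⇒vacant C up (suc k) up<m c∈ hu
    land : ∀ k → 0 + c₁ (1 + k) + c₂ k ≤ ⟦ V low (2 + k) ⟧
    land k = charges-≤ {x = false} (λ ()) (∧-conicalˡ _ _)
      (λ z → let ¬v , s = ∧-true {not (V low (suc k))} z ; c∈ , f = ∧-true {inside n (suc k)} s in
             second-lands k (not-true ¬v) c∈ f)
      (λ ()) (λ ())
      (λ y z → no-adjacent-full 3≤n k (∧-conicalʳ (inside n (suc k)) _ (∧-conicalʳ (not (V low (suc k))) _ z))
                                      (∧-conicalʳ (inside n (2 + k)) _ (∧-conicalʳ (V low (2 + k)) _ y)))

  -- An interior full column is charged to its neighbour with an upper vacancy; no upper
  -- vacancy lies between two full columns, since its lower neighbour needs a lower vacancy beside it.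
  interior-full≤flanked : ∑[ c < 2 + n ] ⟦ interiorFull C up c ⟧ ≤ ∑[ c < 2 + n ] ⟦ flanked C up c ⟧
  interior-full≤flanked = begin
    ∑[ c < 2 + n ] ⟦ interiorFull C up c ⟧  ≡⟨ sym (∑-shift (2 + n) {λ c → ⟦ interiorFull C up c ⟧} refl interior-full-off) ⟩
    ∑[ j < 2 + n ] ⟦ interiorFull C up (suc j) ⟧
      ≤⟨ ∑-charge (2 + n) {b = λ c → ⟦ flanked C up c ⟧} {c₀} {λ _ → 0} {c₂} spread land refl
           (cong (λ x → ⟦ x ∧ interiorFull C up 2 ⟧) (vacant-first-column rp up)) refl (flanked-off 1) (flanked-off 2) ⟩
    ∑[ c < 2 + n ] ⟦ flanked C up c ⟧       ∎
    where
    open ≤-Reasoning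
    interior-full-off : ⟦ interiorFull C up (2 + n) ⟧ ≡ 0
    interior-full-off = cong ⟦_⟧ (trans (cong (interior n (2 + n) ∧_) (full-off C up 1)) (∧-zeroʳ (interior n (2 + n))))
    flanked-off : ∀ d → ⟦ flanked C up (suc (d + n)) ⟧ ≡ 0
    flanked-off d = cong (λ x → ⟦ x ∧ (interiorFull C up (d + n) ∨ interiorFull C up (2 + (d + n))) ⟧)
                         (vacant-off C up d)
    c₀ c₂ : ℕ → ℕ
    c₀ j = ⟦ V up j ∧ interiorFull C up (suc j) ⟧
    c₂ j = ⟦ not (V up j) ∧ interiorFull C up (suc j) ⟧
    spread : ∀ j → ⟦ interiorFull C up (suc j) ⟧ ≤ c₀ j + 0 + c₂ j
    spread j with interiorFull C up (suc j) | V up j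
    ... | false | _     = z≤n
    ... | true  | true  = ≤-refl
    ... | true  | false = ≤-refl
    land : ∀ k → c₀ (2 + k) + 0 + c₂ k ≤ ⟦ flanked C up (2 + k) ⟧
    land k = charges-≤ {y = false}
      (λ x → let v , fi = ∧-true {V up (2 + k)} x in ∧-intro v (∨-introʳ {interiorFull C up (1 + k)} fi))
      (λ ())
      (λ z → let ¬v , fi = ∧-true {not (V up k)} z ; i , f = ∧-true {interior n (1 + k)} fi ; k∈ , 2+k∈ = ∧-true i in
             ∧-intro (∨-resolve (proj₂ (full-sides k f k∈ 2+k∈)) (not-true ¬v)) (∨-introˡ fi))
      (λ _ ())
      (λ x z → let v , fi₃ = ∧-true {V up (2 + k)} x
                   f₁ = ∧-conicalʳ (interior n (1 + k)) _ (∧-conicalʳ (not (V up k)) _ z)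
                   f₃ = ∧-conicalʳ (interior n (3 + k)) _ fi₃ in
               vacant-between-full (1 + k) v f₁ f₃ (house-inside C up (1 + k) (∧-conicalˡ _ _ f₁))
                                                   (house-inside C up (3 + k) (∧-conicalˡ _ _ f₃)))
      (λ ())

  interior-full<up-vacancies : ∀ s → s < 2 + n → unflanked C up s ≡ true →
    ∑[ c < 2 + n ] ⟦ interiorFull C up c ⟧ + 1 ≤ vacancies C up
  interior-full<up-vacancies s s<2+n unflanked-s = begin
    ∑[ c < 2 + n ] ⟦ interiorFull C up c ⟧ + 1
      ≤⟨ +-mono-≤ interior-full≤flanked (≤-reflexive (sym (cong ⟦_⟧ unflanked-s))) ⟩
    ∑[ c < 2 + n ] ⟦ flanked C up c ⟧ + ⟦ unflanked C up s ⟧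
      ≤⟨ +-monoʳ-≤ (∑[ c < 2 + n ] ⟦ flanked C up c ⟧) (∑-term (λ c → ⟦ unflanked C up c ⟧) s<2+n) ⟩
    ∑[ c < 2 + n ] ⟦ flanked C up c ⟧ + ∑[ c < 2 + n ] ⟦ unflanked C up c ⟧
      ≡⟨ sym (∑-distrib-+ (2 + n) (λ c → ⟦ flanked C up c ⟧) (λ c → ⟦ unflanked C up c ⟧)) ⟩
    ∑[ c < 2 + n ] (⟦ flanked C up c ⟧ + ⟦ unflanked C up c ⟧)
      ≡⟨ ∑-cong (2 + n) (λ c → split (V up c) (interiorFull C up (pred c) ∨ interiorFull C up (suc c))) ⟩
    vacancies C up ∎
    where
    open ≤-Reasoning
    split : ∀ v x → ⟦ v ∧ x ⟧ + ⟦ v ∧ not x ⟧ ≡ ⟦ v ⟧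
    split false x     = refl
    split true  true  = refl
    split true  false = refl

  unflanked-intro : ∀ c → V up c ≡ true → interiorFull C up (pred c) ≡ false → interiorFull C up (suc c) ≡ false →
    unflanked C up c ≡ true
  unflanked-intro c v f₀ f₂ rewrite v | f₀ | f₂ = refl

  unflanked-second-column : 3 ≤ n → H low 2 ≡ true → unflanked C up 2 ≡ true
  unflanked-second-column 3≤n hl = unflanked-intro 2 vu₂ refl ¬full₃
    where
    1∈ : inside n 1 ≡ true
    1∈ = inside-suc (≤-trans (s≤s z≤n) 3≤n)
    2∈ : inside n 2 ≡ true
    2∈ = inside-suc (≤-trans (s≤s (s≤s z≤n)) 3≤n)
    3∈ : inside n 3 ≡ true
    3∈ = inside-suc 3≤n
    vl₃ : V low 3 ≡ true
    vl₃ = ∨-resolve (low-house-sides 1 hl 1∈ 3∈) (vacant-first-column rp low)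
    ¬hu₂ : H up 2 ≡ false
    ¬hu₂ with H up 2 in hu
    ... | false = refl
    ... | true  = ⊥-elim (both-vacant 3
                    (∨-resolve (proj₂ (full-sides 1 (∧-intro hu hl) 1∈ 3∈)) (vacant-first-column rp up)) vl₃)
    vu₂ : V up 2 ≡ true
    vu₂ = ¬house⇒vacant C up 2 up<m 2∈ ¬hu₂
    ¬full₃ : interiorFull C up 3 ≡ false
    ¬full₃ rewrite vacant⇒¬house C low 3 vl₃ | ∧-zeroʳ (H up 3) = ∧-zeroʳ (interior n 3)

  unflanked-penultimate-column : 3 ≤ n → ∀ c → 2 + c ≡ n → H low (suc c) ≡ true → unflanked C up (suc c) ≡ true
  unflanked-penultimate-column (s≤s (s≤s (s≤s _))) zero () _
  unflanked-penultimate-column _ (suc c) refl hl = unflanked-intro (2 + c) vu ¬full₀ ¬full₂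
    where
    c∈ : inside n (suc c) ≡ true
    c∈ = inside-pred n c (house-inside C low (2 + c) hl)
    3+c∈ : inside n (3 + c) ≡ true
    3+c∈ = inside-suc {3 + c} {2 + c} ≤-refl
    4+c∉ : inside n (4 + c) ≡ false
    4+c∉ = inside-after {3 + c} {3 + c} ≤-refl
    vl₀ : V low (suc c) ≡ true
    vl₀ = ∨-resolveʳ (low-house-sides (suc c) hl c∈ 3+c∈) (vacant-last-column rp low (2 + c) 4+c∉)
    ¬hu : H up (2 + c) ≡ false
    ¬hu with H up (2 + c) in hu
    ... | false = refl
    ... | true  = ⊥-elim (both-vacant (suc c)
                    (∨-resolveʳ (proj₂ (full-sides (suc c) (∧-intro hu hl) c∈ 3+c∈))
                                (vacant-last-column rp up (2 + c) 4+c∉)) vl₀)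
    vu : V up (2 + c) ≡ true
    vu = ¬house⇒vacant C up (2 + c) up<m (house-inside C low (2 + c) hl) ¬hu
    ¬full₀ : interiorFull C up (suc c) ≡ false
    ¬full₀ rewrite vacant⇒¬house C low (suc c) vl₀ | ∧-zeroʳ (H up (suc c)) = ∧-zeroʳ (interior n (suc c))
    ¬full₂ : interiorFull C up (3 + c) ≡ false
    ¬full₂ rewrite 4+c∉ | ∧-zeroʳ (inside n (2 + c)) = refl

  bottom-rows-vacancy-bound : 3 ≤ n → ∀ s → s < 2 + n → unflanked C up s ≡ true →
    2 * n ≤ 3 * (vacancies C up + vacancies C low) + 2
  bottom-rows-vacancy-bound 3≤n s s<2+n unflanked-s = begin
    2 * n                             ≡⟨ sym (trans (+-assoc (pred (pred n) + pred n) 1 2) (pred²+pred+3≡2* (≤-trans (n≤1+n 2) 3≤n))) ⟩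
    pred (pred n) + pred n + 1 + 2    ≤⟨ +-monoˡ-≤ 2 (pair-bound-≥ (interior-full<up-vacancies s s<2+n unflanked-s)
                                                                  (full-with-right≤low-vacancies 3≤n) partition-interior partition-right) ⟩
    3 * (vacancies C up + vacancies C low) + 2 ∎
    where
    open ≤-Reasoning
    partition-interior = trans (sym (rows-partition rp up (interior n) low<m (vacant-interior rp up) (vacant-interior rp low)))
                               (∑-interior n)
    partition-right = trans (sym (rows-partition rp up (inside n ∘ suc) low<m
                                    (λ c → ∧-conicalʳ (inside n (pred c)) _ ∘ vacant-interior rp up c)
                                    (λ c → ∧-conicalʳ (inside n (pred c)) _ ∘ vacant-interior rp low c)))
                            (∑-inside-with-right n)

no-unflanked-vacancy : ∀ {m n} {C : Config (3 + m) n} → ResistantToPredators C → ResistantToAltruists C → 3 ≤ n →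
  ∀ s → s < 2 + n → unflanked C m s ≡ true → ⊥
no-unflanked-vacancy {m} {n} {C} rp ra 3≤n s s<2+n unflanked-s = 3≰2 (+-cancelˡ-≤ (3 * top) 3 2 (begin
  3 * top + 3                                    ≤⟨ top-rows-vacancy-bound rp ra (s≤s (s≤s z≤n)) (≤-trans (n≤1+n 2) 3≤n) ⟩
  2 * n                                          ≤⟨ bottom-rows-vacancy-bound rp m refl 3≤n s s<2+n unflanked-s ⟩
  3 * (vacancies C m + vacancies C (suc m)) + 2  ≤⟨ +-monoˡ-≤ 2 (*-monoʳ-≤ 3 (vacancies-pair≤top-pair rp m (s≤s (s≤s (n≤1+n m))))) ⟩
  3 * top + 2                                    ∎))
  where
  open ≤-Reasoning
  top = vacancies C 0 + vacancies C 1
  3≰2 : 3 ≤ 2 → ⊥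
  3≰2 (s≤s (s≤s ()))

lemma5p8 : (m n : ℕ) → m > 2 → n > 2 → (C : Config m n) →
    EvolutionaryStable C →
    (i : Fin m) → toℕ i ≡ m ∸ 2 →
    (j₁ j₂ : Fin n) → toℕ j₁ ≡ 1 → toℕ j₂ ≡ n ∸ 2 →
    (C i j₁ ≡ false) × (C i j₂ ≡ false)
lemma5p8 (suc (suc (suc m))) n (s≤s (s≤s (s≤s _))) 3≤n C (_ , rp , ra) i i≡ j₁ j₂ j₁≡ j₂≡ =
    ¬-not (λ house₁ → no-unflanked-vacancy rp ra 3≤n 2 (s≤s (s≤s (≤-trans (s≤s z≤n) 3≤n)))
             (unflanked-second-column rp m refl 3≤n (house-at j₁ house₁ j₁≡)))
  , ¬-not (λ house₂ → no-unflanked-vacancy rp ra 3≤n (suc (n ∸ 2)) (s≤s (s≤s (m∸n≤m n 2)))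
             (unflanked-penultimate-column rp m refl 3≤n (n ∸ 2) (m+[n∸m]≡n (≤-trans (n≤1+n 2) 3≤n))
                                           (house-at j₂ house₂ j₂≡)))
  where
  house-at : ∀ j {c} → C i j ≡ true → toℕ j ≡ c → house C (suc m) (suc c) ≡ true
  house-at j Cij refl = subst (λ r → house C r (suc (toℕ j)) ≡ true) i≡ (trans (house-within C i j) Cij)
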